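{- For every integer $d\ge 2$, the Keller graph $G_d$ is class 1, i.e., its edge-chromatic number equals its degree $4^d-3^d-d$.
   Context: The Keller graph $G_d$ has as vertices the $4^d$ tuples in $\{0,1,2,3\}^d$; two tuples $u,v$ are adjacent iff they differ in at least two coordinates and there is at least one coordinate $i$ with $u_i-v_i\equiv 2\pmod 4$. It is regular of degree $4^d-3^d-d$. A graph is class 1 if its edge-chromatic number equals its maximum degree. -}

module Defs where

open import Data.Nat using (ℕ; zero; suc; _+_; _≤_; _%_)
open import Data.Fin using (Fin; toℕ)
open import Data.Vec using (Vec; []; _∷_; lookup)
open import Data.Product using (Σ; _×_)
open import Relation.Binary.PropositionalEquality using (_≡_; _≢_)
open import Relation.Nullary using (¬_)

KVertex : ℕ → Set
KVertex d = Vec (Fin 4) d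

diffCount : ∀ {d} → KVertex d → KVertex d → ℕ
diffCount [] [] = 0
diffCount (x ∷ u) (y ∷ v) with Data.Fin._≟_ x y
... | Relation.Nullary.yes _ = diffCount u v
... | Relation.Nullary.no _  = suc (diffCount u v)

DiffTwo : Fin 4 → Fin 4 → Set
DiffTwo a b = toℕ a ≡ (toℕ b + 2) % 4

KAdj : ∀ {d} → KVertex d → KVertex d → Set
KAdj {d} u v = (2 ≤ diffCount u v) × Σ (Fin d) (λ i → DiffTwo (lookup u i) (lookup v i))

-- A proper edge colouring with k colours of the graph (V, Adj):
-- a colour for each (unordered) edge, i.e. symmetric on adjacent pairs,
-- such that two distinct edges sharing an endpoint get distinct colours.
record ProperEdgeColouring (V : Set) (Adj : V → V → Set) (k : ℕ) : Set where
  field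
    colour : V → V → Fin k
    symm   : ∀ u v → Adj u v → colour u v ≡ colour v u
    proper : ∀ u v w → Adj u v → Adj u w → v ≢ w → colour u v ≢ colour u w

IsEdgeChromaticNumber : (V : Set) → (V → V → Set) → ℕ → Set
IsEdgeChromaticNumber V Adj k =
  ProperEdgeColouring V Adj k × (∀ m → ProperEdgeColouring V Adj m → k ≤ m)

-- G_d is the Cayley graph of ℤ₄ᵈ whose connection set S (isGenerator) consists of the
-- vectors with at least two nonzero coordinates, one of them equal to 2, and
-- |S| = 4^d − 3^d − d.  Colour the edge {u, u + t} by one of t, −t ∈ S: if t has an odd
-- coordinate, look at the first one, i, and take t or −t according to the parity of u_i,
-- which is exactly what flips when (u, t) is replaced by (u + t, −t); otherwise t = −t.
-- At a fixed vertex u this colour determines t, so the |S| colours form a proper edge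
-- colouring, while the |S| edges at 0 need |S| distinct colours.

module Submission where

open import Defs
open import Data.Nat using (ℕ; zero; suc; _+_; _*_; _∸_; _^_; _≤_; _%_; z≤n; s≤s)
open import Data.Nat.DivMod using (_mod_)
import Data.Nat as ℕ
open import Data.Nat.Properties using (m+n∸n≡m; ∸-+-assoc)
open import Data.Nat.Tactic.RingSolver using (solve-∀)
open import Data.Bool using (Bool; true; false; T; not; if_then_else_)
import Data.Bool as Bool
open import Data.Bool.Properties using (T?; T-irrelevant)
open import Data.Fin using (Fin; suc; toℕ; _≟_)
open import Data.Fin.Patterns using (0F; 1F; 2F; 3F)
open import Data.Fin.Properties using (all?; +↔⊎; 0↔⊥; 1↔⊤; injective⇒≤)
open import Data.Vec using (Vec; []; _∷_; lookup; map; zipWith; replicate)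
open import Data.Vec.Properties using (lookup-zipWith; ≡-dec)
open import Data.Product using (∃; _×_; _,_; proj₁; proj₂)
import Data.Product as Product
open import Data.Sum using (_⊎_; inj₁; inj₂)
import Data.Sum as Sum
open import Data.Sum.Function.Propositional using (_⊎-↔_)
open import Function using (_∘_; id; _↔_; _⇔_; mk↔ₛ′; mk⇔; Inverse; Injection; Equivalence; Injective)
open import Function.Properties.Inverse using (↔-sym; ↔-trans; ↔⇒↣)
open import Relation.Binary.Definitions using (DecidableEquality)
open import Relation.Nullary using (yes; no; contradiction)
open import Relation.Nullary.Decidable using (from-yes; _→-dec_)
open import Relation.Binary.PropositionalEquality

private variable
  d m n : ℕ

ℤ₄ : Set
ℤ₄ = Fin 4

infixl 6 _⊕_ _⊖_
infix 8 ⊝_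

_⊕_ : ℤ₄ → ℤ₄ → ℤ₄
a ⊕ b = (toℕ a + toℕ b) mod 4

⊝_ : ℤ₄ → ℤ₄
⊝ a = (4 ∸ toℕ a) mod 4

_⊖_ : ℤ₄ → ℤ₄ → ℤ₄
b ⊖ a = b ⊕ ⊝ a

odd : ℤ₄ → Bool
odd 1F = true
odd 3F = true
odd _  = false

⊕-⊖-cancel : ∀ a b → a ⊕ (b ⊖ a) ≡ b
⊕-⊖-cancel = from-yes (all? λ a → all? λ b → a ⊕ (b ⊖ a) ≟ b)

⊖-anticomm : ∀ a b → a ⊖ b ≡ ⊝ (b ⊖ a)
⊖-anticomm = from-yes (all? λ a → all? λ b → a ⊖ b ≟ ⊝ (b ⊖ a))

⊝-involutive : ∀ a → ⊝ ⊝ a ≡ a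
⊝-involutive = from-yes (all? λ a → ⊝ ⊝ a ≟ a)

⊖-self : ∀ a → a ⊖ a ≡ 0F
⊖-self = from-yes (all? λ a → a ⊖ a ≟ 0F)

⊖-identityʳ : ∀ a → a ⊖ 0F ≡ a
⊖-identityʳ = from-yes (all? λ a → a ⊖ 0F ≟ a)

⊖≡0⇒≡ : ∀ a b → b ⊖ a ≡ 0F → a ≡ b
⊖≡0⇒≡ = from-yes (all? λ a → all? λ b → (b ⊖ a ≟ 0F) →-dec (a ≟ b))

diffTwo⇒⊖≡2 : ∀ a b → DiffTwo a b → b ⊖ a ≡ 2F
diffTwo⇒⊖≡2 = from-yes (all? λ a → all? λ b →
  (toℕ a ℕ.≟ (toℕ b + 2) % 4) →-dec (b ⊖ a ≟ 2F))

⊖≡2⇒diffTwo : ∀ a b → b ⊖ a ≡ 2F → DiffTwo a b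
⊖≡2⇒diffTwo = from-yes (all? λ a → all? λ b →
  (b ⊖ a ≟ 2F) →-dec (toℕ a ℕ.≟ (toℕ b + 2) % 4))

odd-⊝ : ∀ a → odd (⊝ a) ≡ odd a
odd-⊝ = from-yes (all? λ a → odd (⊝ a) Bool.≟ odd a)

⊝-even : ∀ a → odd a ≡ false → ⊝ a ≡ a
⊝-even = from-yes (all? λ a → (odd a Bool.≟ false) →-dec (⊝ a ≟ a))

odd-⊕-odd : ∀ a b → odd b ≡ true → odd (a ⊕ b) ≡ not (odd a)
odd-⊕-odd = from-yes (all? λ a → all? λ b →
  (odd b Bool.≟ true) →-dec (odd (a ⊕ b) Bool.≟ not (odd a)))

infixl 6 _⊕ᵥ_ _⊖ᵥ_
infix 8 ⊝ᵥ_

_⊕ᵥ_ : Vec ℤ₄ d → Vec ℤ₄ d → Vec ℤ₄ d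
_⊕ᵥ_ = zipWith _⊕_

_⊖ᵥ_ : Vec ℤ₄ d → Vec ℤ₄ d → Vec ℤ₄ d
_⊖ᵥ_ = zipWith _⊖_

⊝ᵥ_ : Vec ℤ₄ d → Vec ℤ₄ d
⊝ᵥ_ = map ⊝_

⊕ᵥ-⊖ᵥ-cancel : ∀ (u v : Vec ℤ₄ d) → u ⊕ᵥ (v ⊖ᵥ u) ≡ v
⊕ᵥ-⊖ᵥ-cancel [] [] = refl
⊕ᵥ-⊖ᵥ-cancel (a ∷ u) (b ∷ v) = cong₂ _∷_ (⊕-⊖-cancel a b) (⊕ᵥ-⊖ᵥ-cancel u v)

⊖ᵥ-anticomm : ∀ (u v : Vec ℤ₄ d) → u ⊖ᵥ v ≡ ⊝ᵥ (v ⊖ᵥ u)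
⊖ᵥ-anticomm [] [] = refl
⊖ᵥ-anticomm (a ∷ u) (b ∷ v) = cong₂ _∷_ (⊖-anticomm a b) (⊖ᵥ-anticomm u v)

⊝ᵥ-involutive : ∀ (t : Vec ℤ₄ d) → ⊝ᵥ ⊝ᵥ t ≡ t
⊝ᵥ-involutive [] = refl
⊝ᵥ-involutive (a ∷ t) = cong₂ _∷_ (⊝-involutive a) (⊝ᵥ-involutive t)

⊖ᵥ-identityʳ : ∀ (t : Vec ℤ₄ d) → t ⊖ᵥ replicate d 0F ≡ t
⊖ᵥ-identityʳ [] = refl
⊖ᵥ-identityʳ (a ∷ t) = cong₂ _∷_ (⊖-identityʳ a) (⊖ᵥ-identityʳ t)

⊖ᵥ-cancelʳ : ∀ (u v w : Vec ℤ₄ d) → v ⊖ᵥ u ≡ w ⊖ᵥ u → v ≡ w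
⊖ᵥ-cancelʳ u v w eq = begin
  v                ≡⟨ ⊕ᵥ-⊖ᵥ-cancel u v ⟨
  u ⊕ᵥ (v ⊖ᵥ u)    ≡⟨ cong (u ⊕ᵥ_) eq ⟩
  u ⊕ᵥ (w ⊖ᵥ u)    ≡⟨ ⊕ᵥ-⊖ᵥ-cancel u w ⟩
  w                ∎
  where open ≡-Reasoning

weight : Vec ℤ₄ d → ℕ
weight [] = 0
weight (0F ∷ t) = weight t
weight (suc _ ∷ t) = suc (weight t)

nonzero : Vec ℤ₄ d → Bool
nonzero [] = false
nonzero (0F ∷ t) = nonzero t
nonzero (suc _ ∷ t) = true

has2 : Vec ℤ₄ d → Bool
has2 [] = false
has2 (0F ∷ t) = has2 t
has2 (1F ∷ t) = has2 t
has2 (2F ∷ t) = true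
has2 (3F ∷ t) = has2 t

isGenerator : Vec ℤ₄ d → Bool
isGenerator [] = false
isGenerator (0F ∷ t) = isGenerator t
isGenerator (1F ∷ t) = has2 t
isGenerator (2F ∷ t) = nonzero t
isGenerator (3F ∷ t) = has2 t

diffCount≡weight : ∀ (u v : Vec ℤ₄ d) → diffCount u v ≡ weight (v ⊖ᵥ u)
diffCount≡weight [] [] = refl
diffCount≡weight (a ∷ u) (b ∷ v) with a ≟ b
... | yes refl rewrite ⊖-self a = diffCount≡weight u v
... | no a≢b with b ⊖ a in eq
...   | 0F    = contradiction (⊖≡0⇒≡ a b eq) a≢b
...   | suc _ = cong suc (diffCount≡weight u v)

lookup⇒has2 : ∀ (t : Vec ℤ₄ d) i → lookup t i ≡ 2F → T (has2 t)
lookup⇒has2 (_  ∷ t) 0F      refl = _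
lookup⇒has2 (0F ∷ t) (suc i) eq   = lookup⇒has2 t i eq
lookup⇒has2 (1F ∷ t) (suc i) eq   = lookup⇒has2 t i eq
lookup⇒has2 (2F ∷ t) (suc i) eq   = _
lookup⇒has2 (3F ∷ t) (suc i) eq   = lookup⇒has2 t i eq

has2⇒lookup : ∀ (t : Vec ℤ₄ d) → T (has2 t) → ∃ λ i → lookup t i ≡ 2F
has2⇒lookup (0F ∷ t) h = Product.map suc id (has2⇒lookup t h)
has2⇒lookup (1F ∷ t) h = Product.map suc id (has2⇒lookup t h)
has2⇒lookup (2F ∷ t) h = 0F , refl
has2⇒lookup (3F ∷ t) h = Product.map suc id (has2⇒lookup t h)

has2⇒1≤weight : ∀ (t : Vec ℤ₄ d) → T (has2 t) → 1 ≤ weight t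
has2⇒1≤weight (0F ∷ t)    h = has2⇒1≤weight t h
has2⇒1≤weight (suc _ ∷ t) h = s≤s z≤n

nonzero⇒1≤weight : ∀ (t : Vec ℤ₄ d) → T (nonzero t) → 1 ≤ weight t
nonzero⇒1≤weight (0F ∷ t)    h = nonzero⇒1≤weight t h
nonzero⇒1≤weight (suc _ ∷ t) h = s≤s z≤n

1≤weight⇒nonzero : ∀ (t : Vec ℤ₄ d) → 1 ≤ weight t → T (nonzero t)
1≤weight⇒nonzero (0F ∷ t)    w = 1≤weight⇒nonzero t w
1≤weight⇒nonzero (suc _ ∷ t) w = _

isGenerator⇒ : ∀ (t : Vec ℤ₄ d) → T (isGenerator t) → 2 ≤ weight t × T (has2 t)
isGenerator⇒ (0F ∷ t) g = isGenerator⇒ t g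
isGenerator⇒ (1F ∷ t) g = s≤s (has2⇒1≤weight t g) , g
isGenerator⇒ (2F ∷ t) g = s≤s (nonzero⇒1≤weight t g) , _
isGenerator⇒ (3F ∷ t) g = s≤s (has2⇒1≤weight t g) , g

isGenerator⇐ : ∀ (t : Vec ℤ₄ d) → 2 ≤ weight t → T (has2 t) → T (isGenerator t)
isGenerator⇐ (0F ∷ t) w       h = isGenerator⇐ t w h
isGenerator⇐ (1F ∷ t) w       h = h
isGenerator⇐ (2F ∷ t) (s≤s w) h = 1≤weight⇒nonzero t w
isGenerator⇐ (3F ∷ t) w       h = h

keller-cayley : ∀ (u v : Vec ℤ₄ d) → KAdj u v ⇔ T (isGenerator (v ⊖ᵥ u))
keller-cayley u v = mk⇔ to from
  where
  to : KAdj u v → T (isGenerator (v ⊖ᵥ u))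
  to (2≤diff , i , two) = isGenerator⇐ (v ⊖ᵥ u)
    (subst (2 ≤_) (diffCount≡weight u v) 2≤diff)
    (lookup⇒has2 (v ⊖ᵥ u) i
      (trans (lookup-zipWith _⊖_ i v u) (diffTwo⇒⊖≡2 (lookup u i) (lookup v i) two)))

  from : T (isGenerator (v ⊖ᵥ u)) → KAdj u v
  from g with isGenerator⇒ (v ⊖ᵥ u) g
  ... | 2≤weight , h with has2⇒lookup (v ⊖ᵥ u) h
  ...   | i , two =
    subst (2 ≤_) (sym (diffCount≡weight u v)) 2≤weight ,
    i , ⊖≡2⇒diffTwo (lookup u i) (lookup v i) (trans (sym (lookup-zipWith _⊖_ i v u)) two)

has2-⊝ᵥ : ∀ (t : Vec ℤ₄ d) → has2 (⊝ᵥ t) ≡ has2 t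
has2-⊝ᵥ [] = refl
has2-⊝ᵥ (0F ∷ t) = has2-⊝ᵥ t
has2-⊝ᵥ (1F ∷ t) = has2-⊝ᵥ t
has2-⊝ᵥ (2F ∷ t) = refl
has2-⊝ᵥ (3F ∷ t) = has2-⊝ᵥ t

nonzero-⊝ᵥ : ∀ (t : Vec ℤ₄ d) → nonzero (⊝ᵥ t) ≡ nonzero t
nonzero-⊝ᵥ [] = refl
nonzero-⊝ᵥ (0F ∷ t) = nonzero-⊝ᵥ t
nonzero-⊝ᵥ (1F ∷ t) = refl
nonzero-⊝ᵥ (2F ∷ t) = refl
nonzero-⊝ᵥ (3F ∷ t) = refl

isGenerator-⊝ᵥ : ∀ (t : Vec ℤ₄ d) → isGenerator (⊝ᵥ t) ≡ isGenerator t
isGenerator-⊝ᵥ [] = refl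
isGenerator-⊝ᵥ (0F ∷ t) = isGenerator-⊝ᵥ t
isGenerator-⊝ᵥ (1F ∷ t) = has2-⊝ᵥ t
isGenerator-⊝ᵥ (2F ∷ t) = nonzero-⊝ᵥ t
isGenerator-⊝ᵥ (3F ∷ t) = has2-⊝ᵥ t

flipped : Vec ℤ₄ d → Vec ℤ₄ d → Bool
flipped [] [] = false
flipped (a ∷ u) (b ∷ t) = if odd b then odd a else flipped u t

orient : Vec ℤ₄ d → Vec ℤ₄ d → Vec ℤ₄ d
orient u t = if flipped u t then ⊝ᵥ t else t

flipped-⊝ᵥ : ∀ (u t : Vec ℤ₄ d) → flipped u (⊝ᵥ t) ≡ flipped u t
flipped-⊝ᵥ [] [] = refl
flipped-⊝ᵥ (a ∷ u) (b ∷ t) rewrite odd-⊝ b =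
  cong (if odd b then odd a else_) (flipped-⊝ᵥ u t)

flipped-⊕ᵥ : ∀ (u t : Vec ℤ₄ d) →
             ⊝ᵥ t ≡ t ⊎ flipped (u ⊕ᵥ t) (⊝ᵥ t) ≡ not (flipped u t)
flipped-⊕ᵥ [] [] = inj₁ refl
flipped-⊕ᵥ (a ∷ u) (b ∷ t) rewrite odd-⊝ b with odd b in b-odd
... | true  = inj₂ (odd-⊕-odd a b b-odd)
... | false = Sum.map₁ (cong₂ _∷_ (⊝-even b b-odd)) (flipped-⊕ᵥ u t)

orient-fixed : ∀ (u t : Vec ℤ₄ d) → ⊝ᵥ t ≡ t → orient u t ≡ t
orient-fixed u t ⊝t≡t with flipped u t
... | true  = ⊝t≡t
... | false = refl

orient-involutive : ∀ (u t : Vec ℤ₄ d) → orient u (orient u t) ≡ t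
orient-involutive u t with flipped u t in f
... | true  rewrite flipped-⊝ᵥ u t | f = ⊝ᵥ-involutive t
... | false rewrite f = refl

orient-⊕ᵥ : ∀ (u t : Vec ℤ₄ d) → orient u t ≡ orient (u ⊕ᵥ t) (⊝ᵥ t)
orient-⊕ᵥ u t with flipped-⊕ᵥ u t
... | inj₁ ⊝t≡t = begin
  orient u t                ≡⟨ orient-fixed u t ⊝t≡t ⟩
  t                         ≡⟨ ⊝t≡t ⟨
  ⊝ᵥ t                      ≡⟨ orient-fixed (u ⊕ᵥ t) (⊝ᵥ t) (cong ⊝ᵥ_ ⊝t≡t) ⟨
  orient (u ⊕ᵥ t) (⊝ᵥ t)    ∎
  where open ≡-Reasoning
... | inj₂ e rewrite e with flipped u t
...   | true  = refl
...   | false = sym (⊝ᵥ-involutive t)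

isGenerator-orient : ∀ (u t : Vec ℤ₄ d) → isGenerator (orient u t) ≡ isGenerator t
isGenerator-orient u t with flipped u t
... | true  = isGenerator-⊝ᵥ t
... | false = refl

orient-injective : ∀ (u s t : Vec ℤ₄ d) → orient u s ≡ orient u t → s ≡ t
orient-injective u s t eq = begin
  s                       ≡⟨ orient-involutive u s ⟨
  orient u (orient u s)   ≡⟨ cong (orient u) eq ⟩
  orient u (orient u t)   ≡⟨ orient-involutive u t ⟩
  t                       ∎
  where open ≡-Reasoning

orient-edge-symmetric : ∀ (u v : Vec ℤ₄ d) → orient u (v ⊖ᵥ u) ≡ orient v (u ⊖ᵥ v)
orient-edge-symmetric u v = begin
  orient u (v ⊖ᵥ u)
    ≡⟨ orient-⊕ᵥ u (v ⊖ᵥ u) ⟩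
  orient (u ⊕ᵥ (v ⊖ᵥ u)) (⊝ᵥ (v ⊖ᵥ u))
    ≡⟨ cong₂ orient (⊕ᵥ-⊖ᵥ-cancel u v) (sym (⊖ᵥ-anticomm u v)) ⟩
  orient v (u ⊖ᵥ v)
    ∎
  where open ≡-Reasoning

count : (Vec ℤ₄ d → Bool) → ℕ
count {zero}  p = if p [] then 1 else 0
count {suc d} p =
  count (p ∘ (0F ∷_)) + (count (p ∘ (1F ∷_)) + (count (p ∘ (2F ∷_)) + count (p ∘ (3F ∷_))))

Fin-if↔T : ∀ b → Fin (if b then 1 else 0) ↔ T b
Fin-if↔T true  = 1↔⊤
Fin-if↔T false = 0↔⊥

∃-[]↔ : {P : Vec ℤ₄ 0 → Set} → ∃ P ↔ P []
∃-[]↔ = mk↔ₛ′ (λ { ([] , x) → x }) ([] ,_) (λ _ → refl) (λ { ([] , _) → refl })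

∃-∷↔ : {P : Vec ℤ₄ (suc d) → Set} →
       ∃ P ↔ (∃ (P ∘ (0F ∷_)) ⊎ (∃ (P ∘ (1F ∷_)) ⊎ (∃ (P ∘ (2F ∷_)) ⊎ ∃ (P ∘ (3F ∷_)))))
∃-∷↔ = mk↔ₛ′
  (λ { (0F ∷ t , x) → inj₁ (t , x)
     ; (1F ∷ t , x) → inj₂ (inj₁ (t , x))
     ; (2F ∷ t , x) → inj₂ (inj₂ (inj₁ (t , x)))
     ; (3F ∷ t , x) → inj₂ (inj₂ (inj₂ (t , x))) })
  (λ { (inj₁ (t , x))                → 0F ∷ t , x
     ; (inj₂ (inj₁ (t , x)))         → 1F ∷ t , x
     ; (inj₂ (inj₂ (inj₁ (t , x))))  → 2F ∷ t , x
     ; (inj₂ (inj₂ (inj₂ (t , x))))  → 3F ∷ t , x })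
  (λ { (inj₁ _) → refl ; (inj₂ (inj₁ _)) → refl
     ; (inj₂ (inj₂ (inj₁ _))) → refl ; (inj₂ (inj₂ (inj₂ _))) → refl })
  (λ { (0F ∷ _ , _) → refl ; (1F ∷ _ , _) → refl
     ; (2F ∷ _ , _) → refl ; (3F ∷ _ , _) → refl })

count-↔ : (p : Vec ℤ₄ d → Bool) → Fin (count p) ↔ ∃ (T ∘ p)
count-↔ {zero}  p = ↔-trans (Fin-if↔T (p [])) (↔-sym ∃-[]↔)
count-↔ {suc d} p = ↔-trans
  (↔-trans +↔⊎ (count-↔ _ ⊎-↔
    ↔-trans +↔⊎ (count-↔ _ ⊎-↔
      ↔-trans +↔⊎ (count-↔ _ ⊎-↔ count-↔ _))))
  (↔-sym ∃-∷↔)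

∃T-≡ : {p : Vec ℤ₄ d → Bool} {x y : ∃ (T ∘ p)} → proj₁ x ≡ proj₁ y → x ≡ y
∃T-≡ {x = t , px} {y = .t , py} refl = cong (t ,_) (T-irrelevant px py)

indexOr : (p : Vec ℤ₄ d → Bool) → Fin (count p) → Vec ℤ₄ d → Fin (count p)
indexOr p default t with T? (p t)
... | yes pt = Inverse.from (count-↔ p) (t , pt)
... | no _   = default

indexOr-injective : ∀ (p : Vec ℤ₄ d → Bool) default {s t} → T (p s) → T (p t) →
                    indexOr p default s ≡ indexOr p default t → s ≡ t
indexOr-injective p default {s} {t} ps pt eq with T? (p s) | T? (p t)
... | yes _ | yes _ = cong proj₁ (Injection.injective (↔⇒↣ (↔-sym (count-↔ p))) eq)
... | no ¬ps | _    = contradiction ps ¬ps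
... | _ | no ¬pt    = contradiction pt ¬pt

four-times : ∀ x → x + x + x + x ≡ 4 * x
four-times = solve-∀

count-all : count {d} (λ _ → true) ≡ 4 ^ d
count-all {zero}  = refl
count-all {suc d} = begin
  A + (A + (A + A))                  ≡⟨ rearrange A ⟩
  A + A + A + A                      ≡⟨ cong (λ x → x + x + x + x) (count-all {d}) ⟩
  4 ^ d + 4 ^ d + 4 ^ d + 4 ^ d      ≡⟨ four-times (4 ^ d) ⟩
  4 ^ suc d                          ∎
  where
  open ≡-Reasoning
  A = count {d} (λ _ → true)
  rearrange : ∀ x → x + (x + (x + x)) ≡ x + x + x + x
  rearrange = solve-∀

count-has2 : count {d} has2 + 3 ^ d ≡ 4 ^ d
count-has2 {zero}  = refl
count-has2 {suc d} = begin
  H + (H + (A + H)) + 3 * 3 ^ d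
    ≡⟨ rearrange H A (3 ^ d) ⟩
  (H + 3 ^ d) + (H + 3 ^ d) + A + (H + 3 ^ d)
    ≡⟨ cong₂ (λ x y → x + x + y + x) (count-has2 {d}) (count-all {d}) ⟩
  4 ^ d + 4 ^ d + 4 ^ d + 4 ^ d
    ≡⟨ four-times (4 ^ d) ⟩
  4 ^ suc d
    ∎
  where
  open ≡-Reasoning
  H = count {d} has2
  A = count {d} (λ _ → true)
  rearrange : ∀ h a p → h + (h + (a + h)) + 3 * p ≡ (h + p) + (h + p) + a + (h + p)
  rearrange = solve-∀

count-nonzero : count {d} nonzero + 1 ≡ 4 ^ d
count-nonzero {zero}  = refl
count-nonzero {suc d} = begin
  Z + (A + (A + A)) + 1
    ≡⟨ rearrange Z A ⟩
  (Z + 1) + A + A + A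
    ≡⟨ cong₂ (λ x y → x + y + y + y) (count-nonzero {d}) (count-all {d}) ⟩
  4 ^ d + 4 ^ d + 4 ^ d + 4 ^ d
    ≡⟨ four-times (4 ^ d) ⟩
  4 ^ suc d
    ∎
  where
  open ≡-Reasoning
  Z = count {d} nonzero
  A = count {d} (λ _ → true)
  rearrange : ∀ z a → z + (a + (a + a)) + 1 ≡ (z + 1) + a + a + a
  rearrange = solve-∀

count-isGenerator : count {d} isGenerator + (3 ^ d + d) ≡ 4 ^ d
count-isGenerator {zero}  = refl
count-isGenerator {suc d} = begin
  I + (H + (Z + H)) + (3 * 3 ^ d + suc d)
    ≡⟨ rearrange I H Z (3 ^ d) d ⟩
  (I + (3 ^ d + d)) + (H + 3 ^ d) + (Z + 1) + (H + 3 ^ d)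
    ≡⟨ cong₂ (λ x y → x + y + (Z + 1) + y) (count-isGenerator {d}) (count-has2 {d}) ⟩
  4 ^ d + 4 ^ d + (Z + 1) + 4 ^ d
    ≡⟨ cong (λ x → 4 ^ d + 4 ^ d + x + 4 ^ d) (count-nonzero {d}) ⟩
  4 ^ d + 4 ^ d + 4 ^ d + 4 ^ d
    ≡⟨ four-times (4 ^ d) ⟩
  4 ^ suc d
    ∎
  where
  open ≡-Reasoning
  I = count {d} isGenerator
  H = count {d} has2
  Z = count {d} nonzero
  rearrange : ∀ i h z p n →
    i + (h + (z + h)) + (3 * p + suc n) ≡ (i + (p + n)) + (h + p) + (z + 1) + (h + p)
  rearrange = solve-∀

degree-formula : ∀ d → count {d} isGenerator ≡ 4 ^ d ∸ 3 ^ d ∸ d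
degree-formula d = begin
  count {d} isGenerator
    ≡⟨ m+n∸n≡m _ (3 ^ d + d) ⟨
  count {d} isGenerator + (3 ^ d + d) ∸ (3 ^ d + d)
    ≡⟨ cong (_∸ (3 ^ d + d)) (count-isGenerator {d}) ⟩
  4 ^ d ∸ (3 ^ d + d)
    ≡⟨ ∸-+-assoc (4 ^ d) (3 ^ d) d ⟨
  4 ^ d ∸ 3 ^ d ∸ d
    ∎
  where open ≡-Reasoning

colours≥degree : ∀ {V : Set} {Adj : V → V → Set} → DecidableEquality V →
                 ProperEdgeColouring V Adj m → (u : V) (f : Fin n → V) →
                 Injective _≡_ _≡_ f → (∀ i → Adj u (f i)) → n ≤ m
colours≥degree _≟ᵥ_ c u f f-injective adj = injective⇒≤ colour∘f-injective
  where
  open ProperEdgeColouring c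
  colour∘f-injective : Injective _≡_ _≡_ (colour u ∘ f)
  colour∘f-injective {i} {j} eq with f i ≟ᵥ f j
  ... | yes fi≡fj = f-injective fi≡fj
  ... | no fi≢fj  = contradiction eq (proper u (f i) (f j) (adj i) (adj j) fi≢fj)

keller-colours≥degree : ProperEdgeColouring (KVertex d) KAdj m → count {d} isGenerator ≤ m
keller-colours≥degree {d} c =
  colours≥degree (≡-dec _≟_) c zeros (proj₁ ∘ to) (to-injective ∘ ∃T-≡) adjacent
  where
  open Inverse (count-↔ {d} isGenerator)
  open Injection (↔⇒↣ (count-↔ {d} isGenerator)) using () renaming (injective to to-injective)
  zeros = replicate d 0F
  adjacent : ∀ i → KAdj zeros (proj₁ (to i))
  adjacent i = Equivalence.from (keller-cayley zeros t)
    (subst (T ∘ isGenerator) (sym (⊖ᵥ-identityʳ t)) (proj₂ (to i)))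
    where t = proj₁ (to i)

kellerColouring : Fin (count {d} isGenerator) →
                  ProperEdgeColouring (KVertex d) KAdj (count {d} isGenerator)
kellerColouring {d} default = record
  { colour = colour
  ; symm   = λ u v _ → cong (indexOr isGenerator default) (orient-edge-symmetric u v)
  ; proper = λ u v w uv uw v≢w eq →
      v≢w (⊖ᵥ-cancelʳ u v w (orient-injective u (v ⊖ᵥ u) (w ⊖ᵥ u)
        (indexOr-injective isGenerator default (generator u v uv) (generator u w uw) eq)))
  }
  where
  colour : Vec ℤ₄ d → Vec ℤ₄ d → Fin (count {d} isGenerator)
  colour u v = indexOr isGenerator default (orient u (v ⊖ᵥ u))
  generator : ∀ (u v : Vec ℤ₄ d) → KAdj u v → T (isGenerator (orient u (v ⊖ᵥ u)))
  generator u v uv =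
    subst T (sym (isGenerator-orient u (v ⊖ᵥ u))) (Equivalence.to (keller-cayley u v) uv)

theorem18 : ∀ (d : ℕ) → 2 ≤ d →
    IsEdgeChromaticNumber (KVertex d) KAdj (4 ^ d ∸ 3 ^ d ∸ d)
theorem18 d@(suc (suc _)) (s≤s (s≤s _)) =
  subst (IsEdgeChromaticNumber (KVertex d) KAdj) (degree-formula d)
    (kellerColouring default , λ _ → keller-colours≥degree)
  where
  -- The only use of 2 ≤ d: S is nonempty.
  default : Fin (count {d} isGenerator)
  default = Inverse.from (count-↔ {d} isGenerator) (2F ∷ 2F ∷ replicate _ 0F , _)
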